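{- Let $A$ be a finite abelian group and let $p$ be a prime divisor of $|A|$. Then $\phi(A)\geq p$.
   Context: For a group $G$, $\phi(G)$ is the smallest $k$ for which there exist subgroups $H_1,\dots,H_k$ and elements $x_1,\dots,x_k$ of $G$ such that $\{H_ix_i:i\in[k]\}$ is an irredundant cover of $G$ (the cosets cover $G$ and no proper subcollection does) and $\bigcap_{i\in[k]}H_i$ is trivial. -}

module Defs where

open import Level using (Level; _⊔_; suc)
open import Data.Nat using (ℕ; _≤_)
open import Data.Fin using (Fin)
open import Data.Fin.Subset using (Subset; _∈_; _∉_)
open import Data.Product using (Σ; ∃; _×_; _,_)
open import Relation.Nullary using (¬_)
open import Relation.Unary using (Pred)
open import Relation.Binary.PropositionalEquality as ≡ using (_≡_)
open import Function.Bundles using (Bijection)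
open import Algebra.Bundles using (Group; AbelianGroup)

HasOrder : ∀ {c ℓ} → AbelianGroup c ℓ → ℕ → Set (c ⊔ ℓ)
HasOrder A n = Bijection (≡.setoid (Fin n)) (AbelianGroup.setoid A)

module _ {c ℓ} (G : Group c ℓ) where
  open Group G

  record IsSubgroup {h : Level} (H : Pred Carrier h) : Set (c ⊔ ℓ ⊔ h) where
    field
      resp   : ∀ {x y} → x ≈ y → H x → H y
      ε-mem  : H ε
      ∙-mem  : ∀ {x y} → H x → H y → H (x ∙ y)
      ⁻¹-mem : ∀ {x} → H x → H (x ⁻¹)

  -- Membership in the right coset H x :  g ∈ H x  iff  g ∙ x⁻¹ ∈ H.
  InCoset : ∀ {h} → Pred Carrier h → Carrier → Carrier → Set h
  InCoset H x g = H (g ∙ x ⁻¹)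

  CoversBy : ∀ {h k} → (Fin k → Pred Carrier h) → (Fin k → Carrier) →
             Subset k → Set (c ⊔ h)
  CoversBy H x S = ∀ g → ∃ λ i → i ∈ S × InCoset (H i) (x i) g

  Covers : ∀ {h k} → (Fin k → Pred Carrier h) → (Fin k → Carrier) → Set (c ⊔ h)
  Covers H x = ∀ g → ∃ λ i → InCoset (H i) (x i) g

  IrredundantCover : ∀ {h k} → (Fin k → Pred Carrier h) → (Fin k → Carrier) →
                     Set (c ⊔ h)
  IrredundantCover {k = k} H x =
    Covers H x ×
    (∀ (S : Subset k) → (∃ λ i → i ∉ S) → ¬ CoversBy H x S)

  TrivialIntersection : ∀ {h k} → (Fin k → Pred Carrier h) → Set (c ⊔ ℓ ⊔ h)
  TrivialIntersection H = ∀ g → (∀ i → H i g) → g ≈ ε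

  -- k is admissible for φ(G): there exist subgroups H_1..H_k and elements
  -- x_1..x_k with {H_i x_i} an irredundant cover and ⋂ H_i trivial.
  -- φ(G) is the least admissible k, so  "φ(G) ≥ p"  means every admissible k is ≥ p.
  Admissible : (h : Level) → ℕ → Set (c ⊔ ℓ ⊔ suc h)
  Admissible h k =
    Σ (Fin k → Pred Carrier h) λ H →
    Σ (Fin k → Carrier) λ x →
      (∀ i → IsSubgroup (H i)) × IrredundantCover H x × TrivialIntersection H

  φ≥ : (h : Level) → ℕ → Set (c ⊔ ℓ ⊔ suc h)
  φ≥ h p = ∀ k → Admissible h k → p ≤ k

-- Let a be an element of order p (Cauchy's theorem) and suppose the cosets H₁x₁, …, Hₖxₖ
-- cover A irredundantly with k < p. For any g, two of the p elements g + t·a (t < p) lie in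
-- a common coset Hᵢxᵢ; their difference is a multiple d·a with 0 < d < p, so a ∈ Hᵢ and then
-- g ∈ Hᵢxᵢ. Hence the cosets whose subgroup contains a already cover A, irredundancy says
-- that these are all of them, and so a ≠ 0 lies in the trivial intersection of the Hᵢ.
--
-- Cauchy's theorem is proved constructively: if A had no element of order p, adjoining the
-- elements of A one by one to the trivial subgroup would keep its order prime to p, because
-- |S + ⟨y⟩| = m·|S| where m, the least positive number with m·y ∈ S, divides the order of y;
-- but the last subgroup is A itself, whose order p divides.

module Submission where

open import Defs
open import Level using (Level; _⊔_) renaming (suc to lsuc)
open import Data.Nat using (ℕ; zero; suc; _+_; _*_; _∸_; _<_; _≤_; _<?_; z<s; s≤s⁻¹; _/_; _%_)
open import Data.Nat.Properties
  using (≤-refl; <-≤-trans; ≤-<-trans; <⇒≤; <-irrefl; ≮⇒≥; n<1+n; m<n⇒m<1+n; m<1+n⇒m<n∨m≡n;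
         m<n⇒0<n∸m; m∸n≤m; m∸n+n≡m; m<m*n; *-comm; *-suc; +-comm; anyUpTo?; +-0-commutativeMonoid)
open import Data.Nat.Base using (>-nonZero; nonTrivial⇒n>1; nonTrivial⇒≢1)
open import Data.Nat.DivMod using (m≡m%n+[m/n]*n; m%n<n)
open import Data.Nat.Divisibility using (_∣_; divides; ∣-trans; ∣1⇒≡1; m%n≡0⇒n∣m)
open import Data.Nat.Primality using (Prime; prime⇒nonTrivial; euclidsLemma)
open import Data.Nat.Coprimality as Coprimality using (Coprime; coprime-Bézout; prime⇒coprime)
open import Data.Nat.GCD using (module Bézout)
open import Data.Fin as Fin using (Fin; zero; suc; toℕ)
open import Data.Fin.Properties using (suc-injective; 0≢1+n; pigeonhole; toℕ<n; any?)
open import Data.Fin.Permutation using (Permutation; permutation; _⟨$⟩ʳ_)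
open import Data.Fin.Subset using (∁; ⁅_⁆)
open import Data.Fin.Subset.Properties using (x∈⁅x⁆; x∈⁅y⁆⇒x≡y; x∈p⇒x∉∁p; x∉p⇒x∈∁p)
open import Data.List using (List; []; _∷_; tabulate)
open import Data.List.Relation.Unary.All as All using (All; []; _∷_)
open import Data.List.Relation.Unary.All.Properties using (tabulate⁻)
open import Data.Product using (∃; _×_; _,_; proj₁; proj₂)
open import Data.Sum using (_⊎_; inj₁; inj₂; [_,_])
open import Data.Empty using (⊥)
open import Function using (_∘_; _⇔_; mk⇔; Equivalence; Bijection)
open import Relation.Nullary using (¬_; Dec; yes; no; ¬?; contradiction)
open import Relation.Nullary.Decidable using (_×-dec_; _⊎-dec_; map′; decidable-stable)
open import Relation.Unary using (Pred; Decidable; _⊆_)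
open import Relation.Unary.Properties using (_∪?_)
open import Relation.Binary.PropositionalEquality as ≡ using (_≡_)
open import Algebra.Bundles using (AbelianGroup)
import Algebra.Properties.AbelianGroup as AbelianGroupProperties
import Algebra.Properties.CommutativeSemigroup as CommutativeSemigroupProperties
import Algebra.Properties.Monoid.Mult as MultProperties
open import Algebra.Properties.CommutativeMonoid.Sum +-0-commutativeMonoid
  using (sum; sum-cong-≗; ∑-distrib-+; sum-permute)

open Equivalence using (to; from)

record LeastPositive {p} (P : Pred ℕ p) (m : ℕ) : Set p where
  field
    positive : 0 < m
    holds    : P m
    minimal  : ∀ {t} → 0 < t → t < m → ¬ P t

leastPositive : ∀ {p} {P : Pred ℕ p} → Decidable P → ∀ {w} → 0 < w → P w → ∃ (LeastPositive P)
leastPositive {P = P} P? {w} 0<w Pw = search (suc w) (w , ≤-refl , 0<w , Pw)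
  where
  search : ∀ v → (∃ λ t → t < v × 0 < t × P t) → ∃ (LeastPositive P)
  search (suc v) (t , t<1+v , 0<t , Pt) with anyUpTo? (λ s → 0 <? s ×-dec P? s) v
  ... | yes smaller = search v smaller
  ... | no  none    = t , record
    { positive = 0<t
    ; holds    = Pt
    ; minimal  = λ 0<s s<t Ps → none (_ , <-≤-trans s<t (s≤s⁻¹ t<1+v) , 0<s , Ps)
    }

indicator : ∀ {p} {P : Set p} → Dec P → ℕ
indicator (yes _) = 1
indicator (no  _) = 0

count : ∀ {n p} {P : Pred (Fin n) p} → Decidable P → ℕ
count P? = sum (λ i → indicator (P? i))

module _ {n p} {P : Pred (Fin n) p} (P? : Decidable P) where

  count-permute : (π : Permutation n n) → count (λ i → P? (π ⟨$⟩ʳ i)) ≡ count P?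
  count-permute π = ≡.sym (sum-permute _ π)

  module _ {q} {Q : Pred (Fin n) q} (Q? : Decidable Q) where

    count-cong : (∀ i → P i ⇔ Q i) → count P? ≡ count Q?
    count-cong P⇔Q = sum-cong-≗ λ i → indicator-cong (P? i) (Q? i) (P⇔Q i)
      where
      indicator-cong : ∀ {a b} {A : Set a} {B : Set b} (A? : Dec A) (B? : Dec B) →
                       A ⇔ B → indicator A? ≡ indicator B?
      indicator-cong (yes _) (yes _) _   = ≡.refl
      indicator-cong (no  _) (no  _) _   = ≡.refl
      indicator-cong (yes a) (no ¬b) A⇔B = contradiction (to A⇔B a) ¬b
      indicator-cong (no ¬a) (yes b) A⇔B = contradiction (from A⇔B b) ¬a

    count-∪ : (∀ i → P i → Q i → ⊥) → count (P? ∪? Q?) ≡ count P? + count Q?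
    count-∪ disjoint = ≡.trans (sum-cong-≗ λ i → indicator-∪ (P? i) (Q? i) (disjoint i))
                               (∑-distrib-+ (indicator ∘ P?) (indicator ∘ Q?))
      where
      indicator-∪ : ∀ {a b} {A : Set a} {B : Set b} (A? : Dec A) (B? : Dec B) →
                    (A → B → ⊥) → indicator (A? ⊎-dec B?) ≡ indicator A? + indicator B?
      indicator-∪ (yes a) (yes b) a⊥b = contradiction b (a⊥b a)
      indicator-∪ (yes _) (no  _) _   = ≡.refl
      indicator-∪ (no  _) (yes _) _   = ≡.refl
      indicator-∪ (no  _) (no  _) _   = ≡.refl

count-none : ∀ {n p} {P : Pred (Fin n) p} (P? : Decidable P) → (∀ i → ¬ P i) → count P? ≡ 0
count-none {zero}  P? none = ≡.refl
count-none {suc n} P? none with P? zero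
... | yes P0 = contradiction P0 (none zero)
... | no  _  = count-none (P? ∘ suc) (none ∘ suc)

count-all : ∀ {n p} {P : Pred (Fin n) p} (P? : Decidable P) → (∀ i → P i) → count P? ≡ n
count-all {zero}  P? all = ≡.refl
count-all {suc n} P? all with P? zero
... | yes _   = ≡.cong suc (count-all (P? ∘ suc) (all ∘ suc))
... | no  ¬P0 = contradiction (all zero) ¬P0

count-singleton : ∀ {n p} {P : Pred (Fin n) p} (P? : Decidable P) (j : Fin n) →
                  (∀ i → P i ⇔ i ≡ j) → count P? ≡ 1
count-singleton {suc n} P? j P⇔≡j with P? zero | j
... | yes _   | zero   =
  ≡.cong suc (count-none (P? ∘ suc) λ i P[1+i] → 0≢1+n (≡.sym (to (P⇔≡j (suc i)) P[1+i])))
... | no  ¬P0 | zero   = contradiction (from (P⇔≡j zero) ≡.refl) ¬P0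
... | yes P0  | suc j′ = contradiction (to (P⇔≡j zero) P0) 0≢1+n
... | no  _   | suc j′ = count-singleton (P? ∘ suc) j′ λ i →
  mk⇔ (suc-injective ∘ to (P⇔≡j (suc i))) (from (P⇔≡j (suc i)) ∘ ≡.cong suc)

module AbelianGroupLemmas {c ℓ} (A : AbelianGroup c ℓ) where
  open AbelianGroup A
  open AbelianGroupProperties A using (⁻¹-∙-comm)
  open CommutativeSemigroupProperties commutativeSemigroup using (interchange; xy∙z≈xz∙y)
  open import Algebra.Properties.Group group using (//-rightDividesʳ; \\-leftDividesʳ; inverseˡ-unique)
  open MultProperties monoid public using (×-congˡ; ×-congʳ; ×-homo-+; ×-assocˡ) renaming (_×_ to _·_)
  open import Relation.Binary.Reasoning.Setoid setoid

  n·ε≈ε : ∀ n → n · ε ≈ ε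
  n·ε≈ε zero    = refl
  n·ε≈ε (suc n) = trans (identityˡ _) (n·ε≈ε n)

  n·x≈ε⇒[m*n]·x≈ε : ∀ m {n x} → n · x ≈ ε → (m * n) · x ≈ ε
  n·x≈ε⇒[m*n]·x≈ε m {n} {x} n·x≈ε = begin
    (m * n) · x   ≈⟨ ×-assocˡ x m n ⟨
    m · (n · x)   ≈⟨ ×-congʳ m n·x≈ε ⟩
    m · ε         ≈⟨ n·ε≈ε m ⟩
    ε             ∎

  xy-xz≈y-z : ∀ x y z → (x ∙ y) - (x ∙ z) ≈ y - z
  xy-xz≈y-z x y z = begin
    (x ∙ y) ∙ (x ∙ z) ⁻¹      ≈⟨ ∙-congˡ (⁻¹-∙-comm x z) ⟨
    (x ∙ y) ∙ (x ⁻¹ ∙ z ⁻¹)   ≈⟨ interchange x y (x ⁻¹) (z ⁻¹) ⟩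
    (x ∙ x ⁻¹) ∙ (y ∙ z ⁻¹)   ≈⟨ ∙-congʳ (inverseʳ x) ⟩
    ε ∙ (y - z)               ≈⟨ identityˡ _ ⟩
    y - z                     ∎

  xy-z-y≈x-z : ∀ x y z → x ∙ y - z - y ≈ x - z
  xy-z-y≈x-z x y z = trans (∙-congʳ (xy∙z≈xz∙y x y (z ⁻¹))) (//-rightDividesʳ y (x - z))

  [xy]⁻¹∙yz≈x⁻¹∙z : ∀ x y z → (x ∙ y) ⁻¹ ∙ (y ∙ z) ≈ x ⁻¹ ∙ z
  [xy]⁻¹∙yz≈x⁻¹∙z x y z = begin
    (x ∙ y) ⁻¹ ∙ (y ∙ z)       ≈⟨ ∙-congʳ (⁻¹-∙-comm x y) ⟨
    (x ⁻¹ ∙ y ⁻¹) ∙ (y ∙ z)    ≈⟨ assoc _ _ _ ⟩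
    x ⁻¹ ∙ (y ⁻¹ ∙ (y ∙ z))    ≈⟨ ∙-congˡ (\\-leftDividesʳ y z) ⟩
    x ⁻¹ ∙ z                   ∎

  n·x-m·x≈[n∸m]·x : ∀ {m n} x → m ≤ n → n · x - m · x ≈ (n ∸ m) · x
  n·x-m·x≈[n∸m]·x {m} {n} x m≤n = begin
    n · x - m · x                  ≡⟨ ≡.cong (λ k → k · x - m · x) (m∸n+n≡m m≤n) ⟨
    ((n ∸ m) + m) · x - m · x      ≈⟨ ∙-congʳ (×-homo-+ x (n ∸ m) m) ⟩
    (n ∸ m) · x ∙ m · x - m · x    ≈⟨ //-rightDividesʳ (m · x) _ ⟩
    (n ∸ m) · x                    ∎

  module Subgroup {h} {H : Pred Carrier h} (H-sub : IsSubgroup group H) where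
    open IsSubgroup H-sub public

    ·-mem : ∀ n {x} → H x → H (n · x)
    ·-mem zero    _  = ε-mem
    ·-mem (suc n) Hx = ∙-mem Hx (·-mem n Hx)

    -‿mem : ∀ {x y} → H x → H y → H (x - y)
    -‿mem Hx Hy = ∙-mem Hx (⁻¹-mem Hy)

    coset-difference : ∀ {x g g′} → InCoset group H x g → InCoset group H x g′ → H (g - g′)
    coset-difference {x} {g} {g′} g∈Hx g′∈Hx =
      resp (xy-xz≈y-z (x ⁻¹) g g′)
           (-‿mem (resp (comm _ _) g∈Hx) (resp (comm _ _) g′∈Hx))

    coset-shift : ∀ {x g y} → InCoset group H x (g ∙ y) → H y → InCoset group H x g
    coset-shift {x} {g} {y} gy∈Hx Hy = resp (xy-z-y≈x-z g y x) (-‿mem gy∈Hx Hy)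

    coprime-multiple-mem : ∀ {d o x} → Coprime d o → o · x ≈ ε → H (d · x) → H x
    coprime-multiple-mem {d} {o} {x} d⊥o o·x≈ε Hdx with coprime-Bézout d⊥o
    ... | Bézout.+- u v eq = resp (begin
      u · (d · x)       ≈⟨ ×-assocˡ x u d ⟩
      (u * d) · x       ≡⟨ ≡.cong (_· x) eq ⟨
      x ∙ (v * o) · x   ≈⟨ ∙-congˡ (n·x≈ε⇒[m*n]·x≈ε v o·x≈ε) ⟩
      x ∙ ε             ≈⟨ identityʳ x ⟩
      x                 ∎) (·-mem u Hdx)
    ... | Bézout.-+ u v eq = resp (sym (inverseˡ-unique x (u · (d · x)) (begin
      x ∙ u · (d · x)   ≈⟨ ∙-congˡ (×-assocˡ x u d) ⟩
      x ∙ (u * d) · x   ≡⟨ ≡.cong (_· x) eq ⟩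
      (v * o) · x       ≈⟨ n·x≈ε⇒[m*n]·x≈ε v o·x≈ε ⟩
      ε                 ∎))) (⁻¹-mem (·-mem u Hdx))

  module _ {p} (p-prime : Prime p) {a} (p·a≈ε : p · a ≈ ε)
           {h k} {H : Fin k → Pred Carrier h} {x : Fin k → Carrier}
           (subgroups : ∀ i → IsSubgroup group (H i)) where

    fewer-than-p-cosets-contain-a : Covers group H x → k < p →
                                    ∀ g → ∃ λ i → H i a × InCoset group (H i) (x i) g
    fewer-than-p-cosets-contain-a cover k<p g
      with pigeonhole k<p (λ t → proj₁ (cover (g ∙ toℕ t · a)))
    ... | s , t , s<t , same = i , a∈Hᵢ , coset-shift g+s·a∈Hᵢxᵢ (·-mem (toℕ s) a∈Hᵢ)
      where
      i = proj₁ (cover (g ∙ toℕ s · a))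
      open Subgroup (subgroups i)

      g+s·a∈Hᵢxᵢ : InCoset group (H i) (x i) (g ∙ toℕ s · a)
      g+s·a∈Hᵢxᵢ = proj₂ (cover (g ∙ toℕ s · a))

      g+t·a∈Hᵢxᵢ : InCoset group (H i) (x i) (g ∙ toℕ t · a)
      g+t·a∈Hᵢxᵢ = ≡.subst (λ j → InCoset group (H j) (x j) (g ∙ toℕ t · a)) (≡.sym same)
                           (proj₂ (cover (g ∙ toℕ t · a)))

      [t∸s]·a∈Hᵢ : H i ((toℕ t ∸ toℕ s) · a)
      [t∸s]·a∈Hᵢ = resp (trans (xy-xz≈y-z g _ _) (n·x-m·x≈[n∸m]·x a (<⇒≤ s<t)))
                        (coset-difference g+t·a∈Hᵢxᵢ g+s·a∈Hᵢxᵢ)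

      a∈Hᵢ : H i a
      a∈Hᵢ = coprime-multiple-mem
        (Coprimality.sym (prime⇒coprime p-prime {{>-nonZero (m<n⇒0<n∸m s<t)}}
                                         (≤-<-trans (m∸n≤m (toℕ t) (toℕ s)) (toℕ<n t))))
        p·a≈ε [t∸s]·a∈Hᵢ

module FiniteAbelianGroup {c ℓ} (A : AbelianGroup c ℓ) {n} (A-order : HasOrder A n) where
  open AbelianGroup A
  open AbelianGroupLemmas A
  open CommutativeSemigroupProperties commutativeSemigroup using (interchange)
  open import Algebra.Properties.Group group
    using (//-rightDividesˡ; //-rightDividesʳ; x≈y⇒x∙y⁻¹≈ε; ε⁻¹≈ε)
  import Relation.Binary.Reasoning.Setoid setoid as ≈-Reasoning

  enum : Fin n → Carrier
  enum = Bijection.to A-order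

  index : Carrier → Fin n
  index = Bijection.to⁻ A-order

  enum-index : ∀ x → enum (index x) ≈ x
  enum-index x = proj₂ (Bijection.strictlySurjective A-order x)

  index-unique : ∀ {i x} → enum i ≈ x → index x ≡ i
  index-unique {x = x} enum-i≈x = Bijection.injective A-order (trans (enum-index x) (sym enum-i≈x))

  index-injective : ∀ {x y} → index x ≡ index y → x ≈ y
  index-injective {x} {y} eq =
    trans (sym (enum-index x)) (trans (reflexive (≡.cong enum eq)) (enum-index y))

  infix 4 _≟_
  _≟_ : ∀ x y → Dec (x ≈ y)
  x ≟ y = map′ index-injective (λ x≈y → index-unique (trans (enum-index y) (sym x≈y)))
               (index x Fin.≟ index y)

  translation : Carrier → Permutation n n
  translation w = permutation (λ i → index (enum i ∙ w)) (λ i → index (enum i - w))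
    (λ i → index-unique (sym (trans (∙-congʳ (enum-index _)) (//-rightDividesˡ w (enum i)))))
    (λ i → index-unique (sym (trans (∙-congʳ (enum-index _)) (//-rightDividesʳ w (enum i)))))

  irredundant-cover-forces : ∀ {h k q} {H : Fin k → Pred Carrier h} {x : Fin k → Carrier}
                               {Q : Fin k → Set q} →
                             (∀ i → IsSubgroup group (H i)) → IrredundantCover group H x →
                             (∀ g → ∃ λ i → Q i × InCoset group (H i) (x i) g) → ∀ j → Q j
  irredundant-cover-forces {H = H} {x} {Q} subgroups (_ , irredundant) covered j
    with any? (λ m → proj₁ (covered (enum m)) Fin.≟ j)
  ... | yes (m , chosen≡j) = ≡.subst Q chosen≡j (proj₁ (proj₂ (covered (enum m))))
  ... | no  j-unused       =
    contradiction covered-without-j (irredundant (∁ ⁅ j ⁆) (j , x∈p⇒x∉∁p (x∈⁅x⁆ j)))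
    where
    covered-without-j : CoversBy group H x (∁ ⁅ j ⁆)
    covered-without-j g =
      i , x∉p⇒x∈∁p (λ i∈⁅j⁆ → j-unused (index g , x∈⁅y⁆⇒x≡y j i∈⁅j⁆)) ,
      IsSubgroup.resp (subgroups i) (∙-congʳ (enum-index g)) (proj₂ (proj₂ covering))
      where
      covering = covered (enum (index g))
      i = proj₁ covering

  Order : Carrier → Pred ℕ ℓ
  Order y = LeastPositive (λ o → o · y ≈ ε)

  order : ∀ y → ∃ (Order y)
  order y with pigeonhole (n<1+n n) (λ (t : Fin (suc n)) → index (toℕ t · y))
  ... | s , t , s<t , same = leastPositive (λ o → o · y ≟ ε) (m<n⇒0<n∸m s<t) (begin
    (toℕ t ∸ toℕ s) · y     ≈⟨ n·x-m·x≈[n∸m]·x y (<⇒≤ s<t) ⟨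
    toℕ t · y - toℕ s · y   ≈⟨ x≈y⇒x∙y⁻¹≈ε (index-injective (≡.sym same)) ⟩
    ε                       ∎)
    where open ≈-Reasoning

  record DecSubgroup : Set (c ⊔ lsuc ℓ) where
    field
      Mem        : Pred Carrier ℓ
      isSubgroup : IsSubgroup group Mem
      mem?       : Decidable Mem
    open Subgroup isSubgroup public

  open DecSubgroup using (Mem; mem?)

  size : DecSubgroup → ℕ
  size S = count (λ i → mem? S (enum i))

  size-translate : ∀ S w → count (λ i → mem? S (enum i ∙ w)) ≡ size S
  size-translate S w = ≡.trans
    (count-cong (λ i → mem? S (enum i ∙ w)) (λ i → mem? S (enum (translation w ⟨$⟩ʳ i)))
                (λ i → mk⇔ (resp (sym (enum-index _))) (resp (enum-index _))))
    (count-permute (λ i → mem? S (enum i)) (translation w))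
    where open DecSubgroup S using (resp)

  trivialSubgroup : DecSubgroup
  trivialSubgroup = record
    { Mem        = _≈ ε
    ; isSubgroup = record
      { resp   = λ x≈y x≈ε → trans (sym x≈y) x≈ε
      ; ε-mem  = refl
      ; ∙-mem  = λ x≈ε y≈ε → trans (∙-cong x≈ε y≈ε) (identityˡ ε)
      ; ⁻¹-mem = λ x≈ε → trans (⁻¹-cong x≈ε) ε⁻¹≈ε
      }
    ; mem?       = _≟ ε
    }

  size-trivial : size trivialSubgroup ≡ 1
  size-trivial = count-singleton _ (index ε) λ i →
    mk⇔ (≡.sym ∘ index-unique)
        (λ i≡index-ε → trans (reflexive (≡.cong enum i≡index-ε)) (enum-index ε))

  module Extension (S : DecSubgroup) (y : Carrier) {m′}
                   (m-least : LeastPositive (λ t → Mem S (t · y)) (suc m′)) where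
    open DecSubgroup S hiding (Mem; mem?)
    open LeastPositive m-least

    m : ℕ
    m = suc m′

    -- S + ⟨y⟩ is the union of the translates S - t·y (t < m), pairwise disjoint by minimality of m.
    Below : ℕ → Pred Carrier ℓ
    Below j z = ∃ λ t → t < j × Mem S (z ∙ t · y)

    below? : ∀ j → Decidable (Below j)
    below? j z = anyUpTo? (λ t → mem? S (z ∙ t · y)) j

    reduce : ∀ {z} t → Mem S (z ∙ t · y) → Mem S (z ∙ (t % m) · y)
    reduce {z} t z+t·y∈S = resp (begin
      z ∙ t · y - q · (m · y)
        ≡⟨ ≡.cong (λ k → z ∙ k · y - q · (m · y)) (m≡m%n+[m/n]*n t m) ⟩
      z ∙ (r + q * m) · y - q · (m · y)
        ≈⟨ ∙-congʳ (∙-congˡ (×-homo-+ y r (q * m))) ⟩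
      z ∙ (r · y ∙ (q * m) · y) - q · (m · y)
        ≈⟨ ∙-congʳ (∙-congˡ (∙-congˡ (×-assocˡ y q m))) ⟨
      z ∙ (r · y ∙ q · (m · y)) - q · (m · y)
        ≈⟨ ∙-congʳ (assoc _ _ _) ⟨
      z ∙ r · y ∙ q · (m · y) - q · (m · y)
        ≈⟨ //-rightDividesʳ _ _ ⟩
      z ∙ r · y ∎) (-‿mem z+t·y∈S (·-mem q holds))
      where
      q = t / m
      r = t % m
      open ≈-Reasoning

    below-m : ∀ {z} t → Mem S (z ∙ t · y) → Below m z
    below-m t z+t·y∈S = t % m , m%n<n t m , reduce t z+t·y∈S

    S+⟨y⟩ : DecSubgroup
    S+⟨y⟩ = record
      { Mem        = Below m
      ; isSubgroup = record
        { resp   = λ { x≈z (t , t<m , x+t·y∈S) → t , t<m , resp (∙-congʳ x≈z) x+t·y∈S }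
        ; ε-mem  = 0 , z<s , resp (sym (identityʳ ε)) ε-mem
        ; ∙-mem  = λ { (t₁ , _ , h₁) (t₂ , _ , h₂) → below-m (t₁ + t₂)
                       (resp (sym (trans (∙-congˡ (×-homo-+ y t₁ t₂)) (interchange _ _ _ _)))
                             (∙-mem h₁ h₂)) }
        ; ⁻¹-mem = λ { {z} (t , _ , h) → below-m (t * m′)
                       (resp (inverse-witness z t) (∙-mem (⁻¹-mem h) (·-mem t holds))) }
        }
      ; mem?       = below? m
      }
      where
      inverse-witness : ∀ z t → (z ∙ t · y) ⁻¹ ∙ t · (m · y) ≈ z ⁻¹ ∙ (t * m′) · y
      inverse-witness z t = begin
        (z ∙ t · y) ⁻¹ ∙ t · (m · y)              ≈⟨ ∙-congˡ (×-assocˡ y t m) ⟩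
        (z ∙ t · y) ⁻¹ ∙ (t * m) · y              ≈⟨ ∙-congˡ (×-congˡ (*-suc t m′)) ⟩
        (z ∙ t · y) ⁻¹ ∙ (t + t * m′) · y         ≈⟨ ∙-congˡ (×-homo-+ y t (t * m′)) ⟩
        (z ∙ t · y) ⁻¹ ∙ (t · y ∙ (t * m′) · y)   ≈⟨ [xy]⁻¹∙yz≈x⁻¹∙z z _ _ ⟩
        z ⁻¹ ∙ (t * m′) · y                       ∎
        where open ≈-Reasoning

    S⊆S+⟨y⟩ : Mem S ⊆ Mem S+⟨y⟩
    S⊆S+⟨y⟩ z∈S = 0 , z<s , resp (sym (identityʳ _)) z∈S

    y∈S+⟨y⟩ : Mem S+⟨y⟩ y
    y∈S+⟨y⟩ = m′ , n<1+n m′ , holds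

    size-below : ∀ j → j ≤ m → count (λ i → below? j (enum i)) ≡ j * size S
    size-below zero    _   = count-none (λ i → below? 0 (enum i)) λ { i (_ , () , _) }
    size-below (suc j) j<m = begin
      count below-1+j?                  ≡⟨ count-cong below-1+j? (below-j? ∪? shifted?) (λ i → split) ⟩
      count (below-j? ∪? shifted?)      ≡⟨ count-∪ below-j? shifted? (λ i → disjoint) ⟩
      count below-j? + count shifted?   ≡⟨ ≡.cong₂ _+_ (size-below j (<⇒≤ j<m)) (size-translate S _) ⟩
      j * size S + size S               ≡⟨ +-comm (j * size S) (size S) ⟩
      suc j * size S                    ∎
      where
      open ≡.≡-Reasoning
      below-1+j? : Decidable (λ i → Below (suc j) (enum i))
      below-1+j? i = below? (suc j) (enum i)
      below-j? : Decidable (λ i → Below j (enum i))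
      below-j? i = below? j (enum i)
      shifted? : Decidable (λ i → Mem S (enum i ∙ j · y))
      shifted? i = mem? S (enum i ∙ j · y)
      split : ∀ {z} → Below (suc j) z ⇔ (Below j z ⊎ Mem S (z ∙ j · y))
      split = mk⇔
        (λ { (t , t<1+j , h) → [ (λ t<j → inj₁ (t , t<j , h)) , (λ { ≡.refl → inj₂ h }) ]
                                 (m<1+n⇒m<n∨m≡n t<1+j) })
        [ (λ { (t , t<j , h) → t , m<n⇒m<1+n t<j , h }) , (λ h → j , n<1+n j , h) ]
      disjoint : ∀ {z} → Below j z → Mem S (z ∙ j · y) → ⊥
      disjoint {z} (t , t<j , h) h′ = minimal (m<n⇒0<n∸m t<j) (≤-<-trans (m∸n≤m j t) j<m)
        (resp (trans (xy-xz≈y-z z _ _) (n·x-m·x≈[n∸m]·x y (<⇒≤ t<j))) (-‿mem h′ h))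

    size-S+⟨y⟩ : size S+⟨y⟩ ≡ m * size S
    size-S+⟨y⟩ = size-below m ≤-refl

    m∣order : ∀ {o} → Order y o → m ∣ o
    m∣order {o} o-order =
      m%n≡0⇒n∣m o m (below-m⇒zero (m%n<n o m) (resp (identityˡ _) (reduce o ε+o·y∈S)))
      where
      ε+o·y∈S : Mem S (ε ∙ o · y)
      ε+o·y∈S = resp (sym (trans (identityˡ _) (LeastPositive.holds o-order))) ε-mem
      below-m⇒zero : ∀ {t} → t < m → Mem S (t · y) → t ≡ 0
      below-m⇒zero {zero}  _   _   = ≡.refl
      below-m⇒zero {suc t} t<m h = contradiction h (minimal z<s t<m)

  module WithoutTorsion {p} (p-prime : Prime p) (no-torsion : ∀ z → p · z ≈ ε → z ≈ ε) where

    p∤order : ∀ {y o} → Order y o → ¬ p ∣ o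
    p∤order o-order (divides zero    o≡0)     = <-irrefl (≡.sym o≡0) (LeastPositive.positive o-order)
    p∤order {y} {o} o-order (divides (suc u) o≡[1+u]p) =
      LeastPositive.minimal o-order z<s [1+u]<o (no-torsion ((suc u) · y) (begin
        p · (suc u · y)   ≈⟨ ×-assocˡ y p (suc u) ⟩
        (p * suc u) · y   ≡⟨ ≡.cong (_· y) (≡.trans (*-comm p (suc u)) (≡.sym o≡[1+u]p)) ⟩
        o · y             ≈⟨ LeastPositive.holds o-order ⟩
        ε                 ∎))
      where
      open ≈-Reasoning
      [1+u]<o : suc u < o
      [1+u]<o = ≡.subst (suc u <_) (≡.sym o≡[1+u]p)
                        (m<m*n (suc u) p (nonTrivial⇒n>1 p {{prime⇒nonTrivial p-prime}}))

    p∤size-trivial : ¬ p ∣ size trivialSubgroup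
    p∤size-trivial p∣1 =
      nonTrivial⇒≢1 {{prime⇒nonTrivial p-prime}} (∣1⇒≡1 (≡.subst (p ∣_) size-trivial p∣1))

    extend : (S : DecSubgroup) → ¬ p ∣ size S → (y : Carrier) →
             ∃ λ T → ¬ p ∣ size T × Mem S ⊆ Mem T × Mem T y
    extend S p∤|S| y with order y
    ... | o , o-order with leastPositive (λ t → mem? S (t · y)) positive o·y∈S
      where
      open LeastPositive o-order using (positive; holds)
      o·y∈S : Mem S (o · y)
      o·y∈S = DecSubgroup.resp S (sym holds) (DecSubgroup.ε-mem S)
    ... | suc m′ , m-least = S+⟨y⟩ , p∤|T| , S⊆S+⟨y⟩ , y∈S+⟨y⟩
      where
      open Extension S y m-least
      p∤|T| : ¬ p ∣ size S+⟨y⟩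
      p∤|T| p∣|T| with euclidsLemma m (size S) p-prime (≡.subst (p ∣_) size-S+⟨y⟩ p∣|T|)
      ... | inj₁ p∣m   = p∤order o-order (∣-trans p∣m (m∣order o-order))
      ... | inj₂ p∣|S| = p∤|S| p∣|S|

    subgroup-containing : (ys : List Carrier) → ∃ λ S → ¬ p ∣ size S × All (Mem S) ys
    subgroup-containing []       = trivialSubgroup , p∤size-trivial , []
    subgroup-containing (y ∷ ys) with subgroup-containing ys
    ... | S , p∤|S| , ys∈S with extend S p∤|S| y
    ... | T , p∤|T| , S⊆T , y∈T = T , p∤|T| , y∈T ∷ All.map S⊆T ys∈S

    p∤n : ¬ p ∣ n
    p∤n p∣n with subgroup-containing (tabulate enum)
    ... | S , p∤|S| , all∈S =
      p∤|S| (≡.subst (p ∣_) (≡.sym (count-all (λ i → mem? S (enum i)) (tabulate⁻ all∈S))) p∣n)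

  cauchy : ∀ {p} → Prime p → p ∣ n → ∃ λ a → ¬ a ≈ ε × p · a ≈ ε
  cauchy {p} p-prime p∣n with any? (λ i → ¬? (enum i ≟ ε) ×-dec (p · enum i ≟ ε))
  ... | yes (i , enum-i≉ε , p·enum-i≈ε) = enum i , enum-i≉ε , p·enum-i≈ε
  ... | no  no-element-of-order-p       = contradiction p∣n (WithoutTorsion.p∤n p-prime no-torsion)
    where
    no-torsion : ∀ z → p · z ≈ ε → z ≈ ε
    no-torsion z p·z≈ε = decidable-stable (z ≟ ε) λ z≉ε → no-element-of-order-p
      (index z , z≉ε ∘ trans (sym (enum-index z)) , trans (×-congʳ p (enum-index z)) p·z≈ε)

lemma4p9 : ∀ {c ℓ} (h : Level) (A : AbelianGroup c ℓ) (n : ℕ) → HasOrder A n →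
           (p : ℕ) → Prime p → p ∣ n →
           φ≥ (AbelianGroup.group A) h p
lemma4p9 h A n A-order p p-prime p∣n k (H , x , subgroups , cover , trivial) = ≮⇒≥ k≮p
  where
  open AbelianGroupLemmas A using (fewer-than-p-cosets-contain-a)
  open FiniteAbelianGroup A A-order using (cauchy; irredundant-cover-forces)

  k≮p : ¬ k < p
  k≮p k<p with cauchy p-prime p∣n
  ... | a , a≉ε , p·a≈ε = a≉ε (trivial a (irredundant-cover-forces subgroups cover
          (fewer-than-p-cosets-contain-a p-prime p·a≈ε subgroups (proj₁ cover) k<p)))
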